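{- For all formulas $A$ and $B$ of the logic of epistemic actions and knowledge (EAK), the following are equivalent: (1) $[\![A]\!]_{\mathbb{Z}}\subseteq[\![B]\!]_{\mathbb{Z}}$; (2) $[\![A]\!]_{M}\subseteq[\![B]\!]_{M}$ for every Kripke model $M$.
   Context: Fix a countable set AtProp of atomic propositions and a nonempty set Ag of agents. EAK-formulas are generated by $A::=p\mid\neg A\mid A\vee A\mid\langle \mathtt{a}\rangle A\mid\langle\alpha\rangle A$ with $p\in$ AtProp, $\mathtt{a}\in$ Ag, and $\alpha$ an action structure $(K,k,(\alpha_{\mathtt a})_{\mathtt a\in Ag},Pre_\alpha)$ ($K$ finite nonempty, $k\in K$, $\alpha_{\mathtt a}\subseteq K\times K$, $Pre_\alpha:K\to$ formulas). A Kripke model is $M=(W,(R_{\mathtt a})_{\mathtt a\in Ag},V)$, equivalently a coalgebra $W\to(\mathcal P W)^{Ag}\times 2^{AtProp}$; $[\![A]\!]_M\subseteq W$ is the set of states satisfying $A$ under the standard EAK (product-update) semantics, where $\langle\alpha\rangle A$ holds at $w$ iff $w$ satisfies $Pre_\alpha(k)$ and $(w,k)$ satisfies $A$ in the updated model $M^\alpha$. EAK-formulas are invariant under bisimulation. $\mathbb Z$ denotes the final coalgebra for this functor (the bisimilarity quotient of the disjoint union of all Kripke models, possibly a proper class): for every model $M$ there is a unique coalgebra morphism (bounded morphism) $f:M\to\mathbb Z$. $[\![A]\!]_{\mathbb Z}=\{z\in\mathbb Z\mid \mathbb Z,z\Vdash A\}$, so that $[\![A]\!]_M=f^{ -1}([\![A]\!]_{\mathbb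 Z})$. -}

module Defs where

open import Level using (Level; _⊔_; Lift) renaming (suc to lsuc; zero to lzero)
open import Data.Nat using (ℕ; suc)
open import Data.Fin using (Fin)
open import Data.Bool using (Bool; true)
open import Data.Product using (Σ; _×_; _,_)
open import Data.Sum using (_⊎_)
open import Data.Empty using (⊥)
open import Relation.Binary.PropositionalEquality using (_≡_)

module EAK (Ag : Set) (AtProp : Set) where

  mutual
    data Formula : Set where
      atom   : AtProp → Formula
      neg    : Formula → Formula
      _∨_    : Formula → Formula → Formula
      ⟨_⟩ag_ : Ag → Formula → Formula
      ⟨_⟩act_ : Action → Formula → Formula

    -- Action structure (K, k, (α_a)_a, Pre) with K = Fin (suc n)
    -- finite and nonempty, relations α_a ⊆ K × K given by their
    -- characteristic functions.
    record Action : Set where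
      inductive
      constructor action
      field
        size : ℕ
        point : Fin (suc size)
        rel   : Ag → Fin (suc size) → Fin (suc size) → Bool
        pre   : Fin (suc size) → Formula

  open Action public

  -- Kripke models  W → (P W)^Ag × 2^AtProp  (at universe level ℓ)
  record Model (ℓ : Level) : Set (lsuc ℓ) where
    field
      W : Set ℓ
      R : Ag → W → W → Set ℓ
      V : W → AtProp → Bool
  open Model public

  mutual
    sat : ∀ {ℓ} (M : Model ℓ) → W M → Formula → Set ℓ
    update : ∀ {ℓ} → Model ℓ → Action → Model ℓ

    update M α = record
      { W = Σ (W M × Fin (suc (size α))) (λ { (w , i) → sat M w (pre α i) })
      ; R = λ { a ((w , i) , _) ((v , j) , _) → R M a w v × (rel α a i j ≡ true) }
      ; V = λ { ((w , _) , _) → V M w }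
      }

    sat {ℓ} M w (atom p)   = Lift ℓ (V M w p ≡ true)
    sat {ℓ} M w (neg A)    = sat M w A → Lift ℓ ⊥
    sat M w (A ∨ B)        = sat M w A ⊎ sat M w B
    sat M w (⟨ a ⟩ag A)    = Σ (W M) λ v → R M a w v × sat M v A
    sat M w (⟨ α ⟩act A)   =
      Σ (sat M w (pre α (point α))) λ p →
        sat (update M α) ((w , point α) , p) A


  Included : ∀ {ℓ} → Model ℓ → Formula → Formula → Set ℓ
  Included M A B = ∀ (w : W M) → sat M w A → sat M w B

  record IsBisimulation {ℓ} (M N : Model ℓ) (Z : W M → W N → Set ℓ) : Set ℓ where
    field
      atoms : ∀ {w v} → Z w v → ∀ p → V M w p ≡ V N v p
      forth : ∀ {w v} a {w'} → Z w v → R M a w w' →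
              Σ (W N) λ v' → R N a v v' × Z w' v'
      back  : ∀ {w v} a {v'} → Z w v → R N a v v' →
              Σ (W M) λ w' → R M a w w' × Z w' v'

  Bisimilar : ∀ {ℓ} (M : Model ℓ) → W M → (N : Model ℓ) → W N → Set (lsuc ℓ)
  Bisimilar {ℓ} M w N v =
    Σ (W M → W N → Set ℓ) λ Z → IsBisimulation M N Z × Z w v

  -- The final coalgebra ℤ (relative to level-ℓ models), presented as the
  -- disjoint union of all level-ℓ Kripke models, with successor relation
  -- taken up to bisimilarity (i.e. the coalgebra structure of the
  -- bisimilarity quotient, presented as a setoid: points are identified
  -- iff Bisimilar).
  ZState : (ℓ : Level) → Set (lsuc ℓ)
  ZState ℓ = Σ (Model ℓ) W

  ℤ : (ℓ : Level) → Model (lsuc ℓ)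
  ℤ ℓ = record
    { W = ZState ℓ
    ; R = λ { a (M , w) (N , v) →
              Σ (W M) λ w' → R M a w w' × Bisimilar M w' N v }
    ; V = λ { (M , w) → V M w }
    }

module Submission where

-- Validity over the final coalgebra ℤ coincides with validity over all
-- Kripke models, because every model M is bisimilar to ℤ via the map
-- w ↦ (M , w), and EAK formulas are invariant under bisimulation.
--
-- Both directions of the
--     theorem are immediate from it, since every state of ℤ has this form.

open import Defs
open import Level using (Level; _⊔_; lift; lower)
open import Data.Nat using (ℕ)
open import Data.Product using (Σ; _×_; _,_)
open import Data.Sum using (inj₁; inj₂)
open import Function.Definitions using (Injective)
open import Function.Bundles using (_⇔_; mk⇔; Equivalence)
open import Relation.Binary.PropositionalEquality using (_≡_; refl; sym; trans)

module Bisimulation (Ag AtProp : Set) where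
  open EAK Ag AtProp
  open Equivalence

  record IsBisimulationᴴ {ℓ₁ ℓ₂ ℓ₃} (M : Model ℓ₁) (N : Model ℓ₂)
                         (Z : W M → W N → Set ℓ₃) : Set (ℓ₁ ⊔ ℓ₂ ⊔ ℓ₃) where
    field
      atoms : ∀ {w v} → Z w v → ∀ p → V M w p ≡ V N v p
      forth : ∀ {w v} a {w'} → Z w v → R M a w w' →
              Σ (W N) λ v' → R N a v v' × Z w' v'
      back  : ∀ {w v} a {v'} → Z w v → R N a v v' →
              Σ (W M) λ w' → R M a w w' × Z w' v'
  open IsBisimulationᴴ

  UpdatedRel : ∀ {ℓ₁ ℓ₂ ℓ₃} {M : Model ℓ₁} {N : Model ℓ₂}
               (Z : W M → W N → Set ℓ₃) (α : Action) →
               W (update M α) → W (update N α) → Set ℓ₃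
  UpdatedRel Z α ((w , i) , _) ((v , j) , _) = Z w v × i ≡ j

  -- Product update preserves a bisimulation Z, as long as Z-related states
  -- agree on every precondition of α (so that related successors survive
  -- the update on both sides).
  update-bisim : ∀ {ℓ₁ ℓ₂ ℓ₃} {M : Model ℓ₁} {N : Model ℓ₂}
                 {Z : W M → W N → Set ℓ₃} →
                 IsBisimulationᴴ M N Z → (α : Action) →
                 (∀ i {w v} → Z w v → sat M w (pre α i) ⇔ sat N v (pre α i)) →
                 IsBisimulationᴴ (update M α) (update N α) (UpdatedRel Z α)
  atoms (update-bisim Z-bisim α pre-inv) (wZv , _) = atoms Z-bisim wZv
  forth (update-bisim Z-bisim α pre-inv) a {(w' , i') , w'⊩pre} (wZv , refl) (Rww' , αii') =
    let (v' , Rvv' , w'Zv') = forth Z-bisim a wZv Rww'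
    in  ((v' , i') , to (pre-inv i' w'Zv') w'⊩pre) , (Rvv' , αii') , (w'Zv' , refl)
  back (update-bisim Z-bisim α pre-inv) a {(v' , i') , v'⊩pre} (wZv , refl) (Rvv' , αii') =
    let (w' , Rww' , w'Zv') = back Z-bisim a wZv Rvv'
    in  ((w' , i') , from (pre-inv i' w'Zv') v'⊩pre) , (Rww' , αii') , (w'Zv' , refl)

  -- The action case uses the induction hypothesis twice: on the
  -- preconditions (to build the updated bisimulation) and on the body.
  bisim-invariance : ∀ {ℓ₁ ℓ₂ ℓ₃} {M : Model ℓ₁} {N : Model ℓ₂}
                     {Z : W M → W N → Set ℓ₃} →
                     IsBisimulationᴴ M N Z →
                     ∀ A {w v} → Z w v → sat M w A ⇔ sat N v A
  bisim-invariance Z-bisim (atom p) wZv =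
    mk⇔ (λ w⊩p → lift (trans (sym (atoms Z-bisim wZv p)) (lower w⊩p)))
        (λ v⊩p → lift (trans (atoms Z-bisim wZv p) (lower v⊩p)))
  bisim-invariance Z-bisim (neg A) wZv =
    mk⇔ (λ w⊮A v⊩A → lift (lower (w⊮A (from (bisim-invariance Z-bisim A wZv) v⊩A))))
        (λ v⊮A w⊩A → lift (lower (v⊮A (to (bisim-invariance Z-bisim A wZv) w⊩A))))
  bisim-invariance Z-bisim (A ∨ B) wZv =
    mk⇔ (λ { (inj₁ w⊩A) → inj₁ (to (bisim-invariance Z-bisim A wZv) w⊩A)
           ; (inj₂ w⊩B) → inj₂ (to (bisim-invariance Z-bisim B wZv) w⊩B) })
        (λ { (inj₁ v⊩A) → inj₁ (from (bisim-invariance Z-bisim A wZv) v⊩A)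
           ; (inj₂ v⊩B) → inj₂ (from (bisim-invariance Z-bisim B wZv) v⊩B) })
  bisim-invariance Z-bisim (⟨ a ⟩ag A) wZv =
    mk⇔ (λ { (w' , Rww' , w'⊩A) →
               let (v' , Rvv' , w'Zv') = forth Z-bisim a wZv Rww'
               in  v' , Rvv' , to (bisim-invariance Z-bisim A w'Zv') w'⊩A })
        (λ { (v' , Rvv' , v'⊩A) →
               let (w' , Rww' , w'Zv') = back Z-bisim a wZv Rvv'
               in  w' , Rww' , from (bisim-invariance Z-bisim A w'Zv') v'⊩A })
  bisim-invariance {M = M} {N} {Z} Z-bisim (⟨ α@(action _ k _ pre) ⟩act A) {w} {v} wZv =
    mk⇔ (λ { (w⊩pre , wk⊩A) → let v⊩pre = to pre-at-point w⊩pre in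
                                 v⊩pre , to (body w⊩pre v⊩pre) wk⊩A })
        (λ { (v⊩pre , vk⊩A) → let w⊩pre = from pre-at-point v⊩pre in
                                 w⊩pre , from (body w⊩pre v⊩pre) vk⊩A })
    where
      pre-at-point : sat M w (pre k) ⇔ sat N v (pre k)
      pre-at-point = bisim-invariance Z-bisim (pre k) wZv

      updated : IsBisimulationᴴ (update M α) (update N α) (UpdatedRel Z α)
      updated = update-bisim Z-bisim α (λ i → bisim-invariance Z-bisim (pre i))

      body : (w⊩pre : sat M w (pre k)) (v⊩pre : sat N v (pre k)) →
             sat (update M α) ((w , k) , w⊩pre) A ⇔ sat (update N α) ((v , k) , v⊩pre) A
      body w⊩pre v⊩pre = bisim-invariance updated A (wZv , refl)

  bisimilar-refl : ∀ {ℓ} (M : Model ℓ) (w : W M) → Bisimilar M w M w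
  bisimilar-refl M w =
      _≡_
    , record { atoms = λ { refl p → refl }
             ; forth = λ { a refl Rww' → _ , Rww' , refl }
             ; back  = λ { a refl Rww' → _ , Rww' , refl } }
    , refl

  -- Bisimilarity is closed under precomposition with a bisimulation Z:
  -- the relational composite of two bisimulations is a bisimulation.
  bisimilar-precompose : ∀ {ℓ} {M N O : Model ℓ} {Z : W M → W N → Set ℓ} →
                         IsBisimulation M N Z →
                         ∀ {w u v} → Z w u → Bisimilar N u O v → Bisimilar M w O v
  bisimilar-precompose {N = N} {Z = Z} Z-bisim {u = u} wZu (Z′ , Z′-bisim , uZ′v) =
      (λ x y → Σ (W N) λ m → Z x m × Z′ m y)
    , record
      { atoms = λ { (m , xZm , mZ′y) p →
          trans (IsBisimulation.atoms Z-bisim xZm p) (IsBisimulation.atoms Z′-bisim mZ′y p) }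
      ; forth = λ { a (m , xZm , mZ′y) Rxx' →
          let (m' , Rmm' , x'Zm') = IsBisimulation.forth Z-bisim a xZm Rxx'
              (y' , Ryy' , m'Z′y') = IsBisimulation.forth Z′-bisim a mZ′y Rmm'
          in  y' , Ryy' , m' , x'Zm' , m'Z′y' }
      ; back  = λ { a (m , xZm , mZ′y) Ryy' →
          let (m' , Rmm' , m'Z′y') = IsBisimulation.back Z′-bisim a mZ′y Ryy'
              (x' , Rxx' , x'Zm') = IsBisimulation.back Z-bisim a xZm Rmm'
          in  x' , Rxx' , m' , x'Zm' , m'Z′y' }
      }
    , u , wZu , uZ′v

  ToFinal : ∀ {ℓ} (M : Model ℓ) → W M → ZState ℓ → Set (Level.suc ℓ)
  ToFinal M w (N , v) = Bisimilar M w N v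

  -- ToFinal M is a bisimulation between M and ℤ.  Going back along a
  -- ℤ-transition lands, up to bisimilarity, at a successor in the
  -- underlying model, which is why precomposition is needed.
  toFinal-bisim : ∀ {ℓ} (M : Model ℓ) → IsBisimulationᴴ M (ℤ ℓ) (ToFinal M)
  atoms (toFinal-bisim M) (Z , Z-bisim , wZv) = IsBisimulation.atoms Z-bisim wZv
  forth (toFinal-bisim M) {v = N , v} a (Z , Z-bisim , wZv) Rww' =
    let (v' , Rvv' , w'Zv') = IsBisimulation.forth Z-bisim a wZv Rww'
    in  (N , v') , (v' , Rvv' , bisimilar-refl N v') , (Z , Z-bisim , w'Zv')
  back (toFinal-bisim M) a (Z , Z-bisim , wZv) (v'' , Rvv'' , v''≃v') =
    let (w' , Rww' , w'Zv'') = IsBisimulation.back Z-bisim a wZv Rvv''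
    in  w' , Rww' , bisimilar-precompose Z-bisim w'Zv'' v''≃v'

  truth-lemma : ∀ {ℓ} (M : Model ℓ) (w : W M) (A : Formula) → sat M w A ⇔ sat (ℤ ℓ) (M , w) A
  truth-lemma M w A = bisim-invariance (toFinal-bisim M) A (bisimilar-refl M w)

-- Lemma 6.1: ⟦A⟧_ℤ ⊆ ⟦B⟧_ℤ iff ⟦A⟧_M ⊆ ⟦B⟧_M for every Kripke model M.
lemma6p1 : ∀ {ℓ : Level} (Ag AtProp : Set) → Ag →
    Σ (AtProp → ℕ) (Injective _≡_ _≡_) →
    (A B : EAK.Formula Ag AtProp) →
    (EAK.Included Ag AtProp (EAK.ℤ Ag AtProp ℓ) A B
    ⇔ (∀ (M : EAK.Model Ag AtProp ℓ) → EAK.Included Ag AtProp M A B))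
lemma6p1 {ℓ} Ag AtProp _ _ A B = mk⇔ final⇒models models⇒final
  where
    open EAK Ag AtProp
    open Bisimulation Ag AtProp
    open Equivalence

    final⇒models : Included (ℤ ℓ) A B → ∀ M → Included M A B
    final⇒models ⟦A⟧⊆⟦B⟧ M w w⊩A =
      from (truth-lemma M w B) (⟦A⟧⊆⟦B⟧ (M , w) (to (truth-lemma M w A) w⊩A))

    models⇒final : (∀ M → Included M A B) → Included (ℤ ℓ) A B
    models⇒final ⟦A⟧⊆⟦B⟧ (M , w) z⊩A =
      to (truth-lemma M w B) (⟦A⟧⊆⟦B⟧ M w (from (truth-lemma M w A) z⊩A))
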